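{- Let $S$ be a modal Kleene algebra and let $a\in S$ be Noetherian. Then $\mathrm{dom}(\mathrm{nrm}\,a)=1$.
   Context: An idempotent semiring is a structure $(S,+,\cdot,0,1)$ such that $(S,+,0)$ is a commutative monoid with $a+a=a$, $(S,\cdot,1)$ is a monoid, multiplication distributes over addition from both sides, and $0a=a0=0$; natural order $a\le b\iff a+b=b$. A test is an element $p\le 1$ for which some $q$ satisfies $p+q=1$ and $pq=0=qp$; $q$ is unique, written $\neg p$; tests form a Boolean algebra $\mathrm{test}(S)$; $p-q=p\cdot\neg q$. $S$ is a modal semiring if for each $a\in S$ there are maps $|a\rangle,\langle a|$ on $\mathrm{test}(S)$ with, for all $a,b,p,q$: $|a\rangle p\le q\iff \neg q\,a\,p\le 0$; $\langle a|p\le q\iff p\,a\,\neg q\le 0$; $|ab\rangle p=|a\rangle(|b\rangle p)$; $\langle ab|p=\langle b|(\langle a|p)$. Domain: $\mathrm{dom}\,a=|a\rangle1$. A Kleene algebra is an idempotent semiring with ${}^*$ such that $1+aa^*\le a^*$, $b+ac\le c\Rightarrow a^*b\le c$, $1+a^*a\le a^*$, $b+ca\le c\Rightarrow ba^*\le c$; a modal Kleene algebra is a Kleene algebra that is a modal semiring. $a$ is Noetherian if for all tests $p$, $p-|a\rangle p\le 0$ implies $p\le 0$. The normaliser of $a$ is $\mathrm{nrm}\,a=a^*\,\neg\mathrm{dom}\,a$. -}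

module Defs where

open import Level using (Level; suc; _⊔_)
open import Data.Product using (Σ; _×_; _,_; proj₁)
open import Relation.Binary.PropositionalEquality using (_≡_)
open import Function.Bundles using (_⇔_)

record IdempotentSemiring (c : Level) : Set (suc c) where
  infixl 6 _+_
  infixl 7 _·_
  field
    Carrier : Set c
    _+_ : Carrier → Carrier → Carrier
    _·_ : Carrier → Carrier → Carrier
    𝟘 𝟙 : Carrier
    +-assoc : ∀ a b c → (a + b) + c ≡ a + (b + c)
    +-comm  : ∀ a b → a + b ≡ b + a
    +-identityˡ : ∀ a → 𝟘 + a ≡ a
    +-idem  : ∀ a → a + a ≡ a
    ·-assoc : ∀ a b c → (a · b) · c ≡ a · (b · c)
    ·-identityˡ : ∀ a → 𝟙 · a ≡ a
    ·-identityʳ : ∀ a → a · 𝟙 ≡ a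
    distribˡ : ∀ a b c → a · (b + c) ≡ a · b + a · c
    distribʳ : ∀ a b c → (b + c) · a ≡ b · a + c · a
    zeroˡ : ∀ a → 𝟘 · a ≡ 𝟘
    zeroʳ : ∀ a → a · 𝟘 ≡ 𝟘

  _≤_ : Carrier → Carrier → Set c
  a ≤ b = a + b ≡ b

  IsComplement : Carrier → Carrier → Set c
  IsComplement p q = (p + q ≡ 𝟙) × (p · q ≡ 𝟘) × (q · p ≡ 𝟘)

  IsTest : Carrier → Set c
  IsTest p = (p ≤ 𝟙) × Σ Carrier (IsComplement p)

-- Modal semiring: diamonds |a⟩ and ⟨a| are maps on tests, given here as
-- maps on the carrier that send tests to tests; the axioms quantify over
-- tests only. Since complements of tests are unique, "¬q" is expressed
-- by an arbitrary complement q' of q.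
record ModalKleeneAlgebra (c : Level) : Set (suc c) where
  field
    semiring : IdempotentSemiring c
  open IdempotentSemiring semiring public
  field
    _⋆ : Carrier → Carrier
    ⋆-unfoldˡ : ∀ a → (𝟙 + a · (a ⋆)) ≤ (a ⋆)
    ⋆-inductˡ : ∀ a b c → (b + a · c) ≤ c → ((a ⋆) · b) ≤ c
    ⋆-unfoldʳ : ∀ a → (𝟙 + (a ⋆) · a) ≤ (a ⋆)
    ⋆-inductʳ : ∀ a b c → (b + c · a) ≤ c → (b · (a ⋆)) ≤ c

    fdia : Carrier → Carrier → Carrier
    bdia : Carrier → Carrier → Carrier
    fdia-test : ∀ a p → IsTest p → IsTest (fdia a p)
    bdia-test : ∀ a p → IsTest p → IsTest (bdia a p)
    fdia-adj : ∀ a p q q' → IsTest p → IsTest q → IsComplement q q' →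
               (fdia a p ≤ q) ⇔ ((q' · a · p) ≤ 𝟘)
    bdia-adj : ∀ a p q q' → IsTest p → IsTest q → IsComplement q q' →
               (bdia a p ≤ q) ⇔ ((p · a · q') ≤ 𝟘)
    fdia-comp : ∀ a b p → IsTest p → fdia (a · b) p ≡ fdia a (fdia b p)
    bdia-comp : ∀ a b p → IsTest p → bdia (a · b) p ≡ bdia b (bdia a p)

  dom : Carrier → Carrier
  dom a = fdia a 𝟙

  -- a is Noetherian: for all tests p, p - |a⟩p ≤ 0 implies p ≤ 0,
  -- where p - q = p · ¬q (¬q given as any complement of the test q)
  Noetherian : Carrier → Set c
  Noetherian a = ∀ p → IsTest p → ∀ r → IsComplement (fdia a p) r →
                 (p · r) ≤ 𝟘 → p ≤ 𝟘

  IsNrm : Carrier → Carrier → Set c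
  IsNrm a n = Σ Carrier λ r → IsComplement (dom a) r × (n ≡ (a ⋆) · r)

module Submission where

-- Let n = a⋆·r with r = ¬dom a, let p = dom n and p' = ¬p.  Since p'·n = 0
-- and 1 ≤ a⋆, a·a⋆ ≤ a⋆, we get p'·r = 0 (p' ≤ dom a) and p'·a·n = 0, and
-- locality of domain turns the latter into p'·a·p = 0 (no a-step leaves p').
-- A state of p' therefore has an a-successor and all of them lie in p', so
-- p' - |a⟩p' = 0; Noetherianity gives p' = 0, i.e. dom n = 1.

open import Defs
open import Level using (Level)
open import Data.Product using (_,_; proj₁; proj₂)
open import Function.Bundles using (Equivalence)
open import Relation.Binary.PropositionalEquality
  using (_≡_; sym; trans; cong; cong₂; subst)
open Relation.Binary.PropositionalEquality.≡-Reasoning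

module SemiringTests {c : Level} (S : IdempotentSemiring c) where
  open IdempotentSemiring S

  +-identityʳ : ∀ x → x + 𝟘 ≡ x
  +-identityʳ x = trans (+-comm x 𝟘) (+-identityˡ x)

  ≤0⇒≡0 : ∀ {x} → x ≤ 𝟘 → x ≡ 𝟘
  ≤0⇒≡0 {x} h = trans (sym (+-identityʳ x)) h

  ≡0⇒≤0 : ∀ {x} → x ≡ 𝟘 → x ≤ 𝟘
  ≡0⇒≤0 {x} e = trans (+-identityʳ x) e

  ≤-zero : ∀ {x y} → x ≤ y → y ≡ 𝟘 → x ≡ 𝟘
  ≤-zero {x} h e = ≤0⇒≡0 (subst (x ≤_) e h)

  +-≤ˡ : ∀ {x y z} → (x + y) ≤ z → x ≤ z
  +-≤ˡ {x} {y} {z} h = begin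
    x + z             ≡⟨ cong (x +_) (sym h) ⟩
    x + ((x + y) + z) ≡⟨ sym (+-assoc x (x + y) z) ⟩
    (x + (x + y)) + z ≡⟨ cong (_+ z) (sym (+-assoc x x y)) ⟩
    ((x + x) + y) + z ≡⟨ cong (λ w → (w + y) + z) (+-idem x) ⟩
    (x + y) + z       ≡⟨ h ⟩
    z                 ∎

  +-≤ʳ : ∀ {x y z} → (x + y) ≤ z → y ≤ z
  +-≤ʳ {x} {y} {z} h = +-≤ˡ (subst (_≤ z) (+-comm x y) h)

  ·-monoʳ : ∀ {x y} z → x ≤ y → (z · x) ≤ (z · y)
  ·-monoʳ z h = trans (sym (distribˡ z _ _)) (cong (z ·_) h)

  ·-monoˡ : ∀ {x y} z → x ≤ y → (x · z) ≤ (y · z)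
  ·-monoˡ z h = trans (sym (distribʳ z _ _)) (cong (_· z) h)

  zero-extˡ : ∀ {x} z → x ≡ 𝟘 → x · z ≡ 𝟘
  zero-extˡ z e = trans (cong (_· z) e) (zeroˡ z)

  zero-extʳ : ∀ {x} z → x ≡ 𝟘 → z · x ≡ 𝟘
  zero-extʳ z e = trans (cong (z ·_) e) (zeroʳ z)

  insert-zero : ∀ {t} x y → t ≤ 𝟙 → x · y ≡ 𝟘 → x · (t · y) ≡ 𝟘
  insert-zero {t} x y t≤1 = ≤-zero (·-monoʳ x t·y≤y)
    where
    t·y≤y : (t · y) ≤ y
    t·y≤y = subst ((t · y) ≤_) (·-identityˡ y) (·-monoˡ y t≤1)

  complement-sym : ∀ {p q} → IsComplement p q → IsComplement q p
  complement-sym {p} {q} (sum , pq , qp) = trans (+-comm q p) sum , qp , pq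

  complement-test : ∀ {p q} → IsComplement p q → IsTest q
  complement-test {p} {q} pq = +-≤ʳ (subst (_≤ 𝟙) (sym (proj₁ pq)) (+-idem 𝟙))
                             , p , complement-sym pq

  𝟙-test : IsTest 𝟙
  𝟙-test = +-idem 𝟙 , 𝟘 , (+-identityʳ 𝟙 , zeroʳ 𝟙 , zeroˡ 𝟙)

  complement-zero : ∀ {p q} → IsComplement p q → q ≡ 𝟘 → p ≡ 𝟙
  complement-zero {p} {q} pq q≡0 = begin
    p     ≡⟨ sym (+-identityʳ p) ⟩
    p + 𝟘 ≡⟨ cong (p +_) (sym q≡0) ⟩
    p + q ≡⟨ proj₁ pq ⟩
    𝟙     ∎

  partition : ∀ {p q} x → IsComplement p q → x ≡ x · p + x · q
  partition {p} {q} x pq = begin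
    x             ≡⟨ sym (·-identityʳ x) ⟩
    x · 𝟙         ≡⟨ cong (x ·_) (sym (proj₁ pq)) ⟩
    x · (p + q)   ≡⟨ distribˡ x p q ⟩
    x · p + x · q ∎

  annihilated-by-partition : ∀ {p q} x → IsComplement p q →
                             x · p ≡ 𝟘 → x · q ≡ 𝟘 → x ≡ 𝟘
  annihilated-by-partition x pq xp xq = begin
    x             ≡⟨ partition x pq ⟩
    x · _ + x · _ ≡⟨ cong₂ _+_ xp xq ⟩
    𝟘 + 𝟘         ≡⟨ +-idem 𝟘 ⟩
    𝟘             ∎

  product-complement : ∀ {s sn t tn} → IsComplement s sn → IsComplement t tn →
                       t ≤ 𝟙 → IsComplement (s · t) (sn + s · tn)
  product-complement {s} {sn} {t} {tn} s-sn t-tn t≤1 = sum , left , right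
    where
    s≤1 : s ≤ 𝟙
    s≤1 = proj₁ (complement-test (complement-sym s-sn))

    sum : s · t + (sn + s · tn) ≡ 𝟙
    sum = begin
      s · t + (sn + s · tn) ≡⟨ cong (s · t +_) (+-comm sn (s · tn)) ⟩
      s · t + (s · tn + sn) ≡⟨ sym (+-assoc _ _ _) ⟩
      (s · t + s · tn) + sn ≡⟨ cong (_+ sn) (sym (partition s t-tn)) ⟩
      s + sn                ≡⟨ proj₁ s-sn ⟩
      𝟙                     ∎

    -- s·t·¬s = 0 and s·t·s·¬t = 0, by inserting t resp. s into s·¬s, s·t·¬t.
    left : s · t · (sn + s · tn) ≡ 𝟘
    left = trans (distribˡ _ _ _) (trans (cong₂ _+_
      (trans (·-assoc s t sn) (insert-zero s sn t≤1 (proj₁ (proj₂ s-sn))))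
      (insert-zero (s · t) tn s≤1
        (trans (·-assoc s t tn) (zero-extʳ s (proj₁ (proj₂ t-tn))))))
      (+-idem 𝟘))

    -- ¬s·s·t = 0 and s·¬t·s·t = 0, the latter by inserting s into s·¬t·t.
    right : (sn + s · tn) · (s · t) ≡ 𝟘
    right = trans (distribʳ _ _ _) (trans (cong₂ _+_
      (trans (sym (·-assoc sn s t)) (zero-extˡ t (proj₂ (proj₂ s-sn))))
      (insert-zero (s · tn) t s≤1
        (trans (·-assoc s tn t) (zero-extʳ s (proj₂ (proj₂ t-tn))))))
      (+-idem 𝟘))

module ModalFacts {c : Level} (S : ModalKleeneAlgebra c) where
  open ModalKleeneAlgebra S
  open SemiringTests semiring

  fdia-complement-annihilates : ∀ a {p q} → IsTest p → IsComplement (fdia a p) q →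
                                q · a · p ≡ 𝟘
  fdia-complement-annihilates a {p} {q} p-test compl =
    ≤0⇒≡0 (Equivalence.to (fdia-adj a p (fdia a p) q p-test (fdia-test a p p-test) compl)
                          (+-idem (fdia a p)))

  fdia-least : ∀ a {p q q'} → IsTest p → IsTest q → IsComplement q q' →
               q' · a · p ≡ 𝟘 → fdia a p ≤ q
  fdia-least a {p} {q} {q'} p-test q-test compl e =
    Equivalence.from (fdia-adj a p q q' p-test q-test compl) (≡0⇒≤0 e)

  dom-annihilated : ∀ {t tn} b → IsComplement t tn → t · b ≡ 𝟘 → t · dom b ≡ 𝟘
  dom-annihilated {t} {tn} b t-tn e = ≤-zero (·-monoʳ t dom≤tn) (proj₁ (proj₂ t-tn))
    where
    dom≤tn : dom b ≤ tn
    dom≤tn = fdia-least b 𝟙-test (complement-test t-tn) (complement-sym t-tn)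
                        (trans (·-identityʳ (t · b)) e)

  dom-locality : ∀ a b {q q'} → IsTest q → IsComplement q q' →
                 q' · (a · b) ≡ 𝟘 → q' · a · dom b ≡ 𝟘
  dom-locality a b {q} {q'} q-test compl e =
    ≤0⇒≡0 (Equivalence.to (fdia-adj a (dom b) q q' dom-b-test q-test compl) |a⟩dom-b≤q)
    where
    dom-b-test : IsTest (dom b)
    dom-b-test = fdia-test b 𝟙 𝟙-test

    |a⟩dom-b≤q : fdia a (dom b) ≤ q
    |a⟩dom-b≤q = subst (_≤ q) (fdia-comp a b 𝟙 𝟙-test)
      (fdia-least (a · b) 𝟙-test q-test compl
        (trans (·-identityʳ _) e))

  1≤⋆ : ∀ a → 𝟙 ≤ (a ⋆)
  1≤⋆ a = +-≤ˡ (⋆-unfoldˡ a)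

  ·⋆≤⋆ : ∀ a → (a · (a ⋆)) ≤ (a ⋆)
  ·⋆≤⋆ a = +-≤ʳ (⋆-unfoldˡ a)

  -- If every state of ¬p lies in dom a (¬p·¬dom a = 0) and no a-step leads
  -- from ¬p into p, then every state of ¬p has an a-successor in ¬p:
  -- ¬p - |a⟩¬p = 0.  The test x = ¬p·¬|a⟩¬p kills a (split over p, ¬p),
  -- hence dom a, and it kills ¬dom a since ¬p does; so x = 0.
  trapped-states-progress : ∀ a {p p' r r'} → IsComplement p p' →
    IsComplement (fdia a p') r' → IsComplement (dom a) r →
    p' · a · p ≡ 𝟘 → p' · r ≡ 𝟘 → p' · r' ≡ 𝟘
  trapped-states-progress a {p} {p'} {r} {r'} p-p' step-r' dom-r stays p'r≡0 =
    annihilated-by-partition (p' · r') dom-r x·dom-a≡0 x·r≡0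
    where
    r'≤1 : r' ≤ 𝟙
    r'≤1 = proj₁ (complement-test step-r')

    x-compl : IsComplement (p' · r') (p + p' · fdia a p')
    x-compl = product-complement (complement-sym p-p') (complement-sym step-r') r'≤1

    x·a·p≡0 : p' · r' · a · p ≡ 𝟘
    x·a·p≡0 = begin
      p' · r' · a · p     ≡⟨ ·-assoc (p' · r') a p ⟩
      p' · r' · (a · p)   ≡⟨ ·-assoc p' r' (a · p) ⟩
      p' · (r' · (a · p)) ≡⟨ insert-zero p' (a · p) r'≤1 (trans (sym (·-assoc p' a p)) stays) ⟩
      𝟘                   ∎

    x·a·p'≡0 : p' · r' · a · p' ≡ 𝟘
    x·a·p'≡0 = begin
      p' · r' · a · p'   ≡⟨ cong (_· p') (·-assoc p' r' a) ⟩
      p' · (r' · a) · p' ≡⟨ ·-assoc p' (r' · a) p' ⟩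
      p' · (r' · a · p') ≡⟨ zero-extʳ p' (fdia-complement-annihilates a
                                           (complement-test p-p') step-r') ⟩
      𝟘                  ∎

    x·dom-a≡0 : p' · r' · dom a ≡ 𝟘
    x·dom-a≡0 = dom-annihilated a x-compl
                  (annihilated-by-partition (p' · r' · a) p-p' x·a·p≡0 x·a·p'≡0)

    x·r≡0 : p' · r' · r ≡ 𝟘
    x·r≡0 = trans (·-assoc p' r' r) (insert-zero p' r r'≤1 p'r≡0)

  nrm-total : ∀ a → Noetherian a → ∀ {r} → IsComplement (dom a) r →
              dom ((a ⋆) · r) ≡ 𝟙
  nrm-total a noetherian {r} dom-r = complement-zero p-p' p'≡0
    where
    n : Carrier
    n = (a ⋆) · r

    p-test : IsTest (dom n)
    p-test = fdia-test n 𝟙 𝟙-test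

    p' : Carrier
    p' = proj₁ (proj₂ p-test)

    p-p' : IsComplement (dom n) p'
    p-p' = proj₂ (proj₂ p-test)

    p'·n≡0 : p' · n ≡ 𝟘
    p'·n≡0 = trans (sym (·-identityʳ (p' · n)))
                   (fdia-complement-annihilates n 𝟙-test p-p')

    -- ¬dom n annihilates every summand of n = r + a·n + ...
    p'·r≡0 : p' · r ≡ 𝟘
    p'·r≡0 = ≤-zero (subst (λ w → (p' · w) ≤ (p' · n)) (·-identityˡ r)
                           (·-monoʳ p' (·-monoˡ r (1≤⋆ a))))
                    p'·n≡0

    p'·a·n≡0 : p' · (a · n) ≡ 𝟘
    p'·a·n≡0 = ≤-zero (subst (λ w → (p' · w) ≤ (p' · n)) (·-assoc a (a ⋆) r)
                             (·-monoʳ p' (·-monoˡ r (·⋆≤⋆ a))))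
                      p'·n≡0

    p'-test : IsTest p'
    p'-test = complement-test p-p'

    step-test : IsTest (fdia a p')
    step-test = fdia-test a p' p'-test

    r' : Carrier
    r' = proj₁ (proj₂ step-test)

    step-r' : IsComplement (fdia a p') r'
    step-r' = proj₂ (proj₂ step-test)

    p'≡0 : p' ≡ 𝟘
    p'≡0 = ≤0⇒≡0 (noetherian p' p'-test r' step-r' (≡0⇒≤0
             (trapped-states-progress a p-p' step-r' dom-r
               (dom-locality a n p-test p-p' p'·a·n≡0) p'·r≡0)))

lemma9p4 : ∀ {c : Level} (S : ModalKleeneAlgebra c) (a : ModalKleeneAlgebra.Carrier S) →
    ModalKleeneAlgebra.Noetherian S a →
    ∀ n → ModalKleeneAlgebra.IsNrm S a n →
    ModalKleeneAlgebra.dom S n ≡ ModalKleeneAlgebra.𝟙 S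
lemma9p4 S a noetherian n (r , dom-r , n≡a⋆r) =
  subst (λ m → ModalKleeneAlgebra.dom S m ≡ ModalKleeneAlgebra.𝟙 S) (sym n≡a⋆r)
        (ModalFacts.nrm-total S a noetherian dom-r)
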